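{- Let $x=x_1\ldots x_m$ and $y=y_1\ldots y_n$ be strings, and consider the network $\mathrm{LCSNET}(x,y)$ with 0/1 inputs. For $i\in[0:m]$, $j\in[0:n]$ let $L(i,j)$ be the length of a longest common subsequence of $x_1\ldots x_i$ and $y_1\ldots y_j$ (so $L(0,j)=L(i,0)=0$). Say that cell $(i,j)$, $i\in[1:m]$, $j\in[1:n]$, belongs to a contour of $L$ if $L(i,j)>L(i-1,j)$, or $L(i,j)>L(i,j-1)$, or $L(i,j)>L(i-1,j-1)$. Say that cell $(i,j)$ has a stray value as input or output if its top input is $1$, or its left input is $0$, or its bottom output is $1$, or its right output is $0$. Then a cell belongs to a contour of $L$ if and only if it has at least one stray value as an input or output.
   Context: $[i:j]$ denotes $\{i,\ldots,j\}$. Network $\mathrm{LCSNET}(x,y)$ with 0/1 inputs: a grid of cells $(i,j)$, $i\in[1:m]$, $j\in[1:n]$; cell $(i,j)$ is a match cell if $x_i=y_j$, otherwise a mismatch cell. Each cell has a left input, a top input, a right output and a bottom output; for $j<n$ the right output of $(i,j)$ is the left input of $(i,j+1)$, for $i<m$ the bottom output of $(i,j)$ is the top input of $(i+1,j)$. The left input of every cell $(i,1)$ is $1$ and the top input of every cell $(1,j)$ is $0$. A match cell passes its top input to its right output and its left input to its bottom output. A mismatch cell is a comparator returning the smaller of its two inputs at its bottom output and the larger at its right output (if the inputs are equal, the top input goes to the bottom output and the left input to the right output). Ones travelling downwards (entering a cell at the top or leaving it at the bottom) and zeros travelling rightwards (entering at the left or leaving at the right) are called stray. -}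

module Defs where

open import Data.Bool using (Bool; true; false; if_then_else_; _∧_; _∨_)
open import Data.Nat using (ℕ; zero; suc; _≤_; _<_)
open import Data.Product using (_×_; _,_; proj₁; proj₂; ∃-syntax)
open import Data.Sum using (_⊎_)
open import Data.Maybe using (Maybe; just; nothing)
open import Data.Vec using (Vec; []; _∷_)
open import Data.List using (List; length)
open import Data.List.Relation.Binary.Sublist.Propositional using (_⊆_)
open import Relation.Binary.PropositionalEquality using (_≡_)
open import Relation.Binary.Definitions using (DecidableEquality)
open import Relation.Nullary.Decidable using (⌊_⌋)

IsLCSLength : {A : Set} → List A → List A → ℕ → Set
IsLCSLength xs ys k =
  (∃[ zs ] (zs ⊆ xs × zs ⊆ ys × length zs ≡ k))
  × (∀ zs → zs ⊆ xs → zs ⊆ ys → length zs ≤ k)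

-- "cell (i,j) belongs to a contour of L" (1-based indices i, j ≥ 1)
OnContour : (ℕ → ℕ → ℕ) → ℕ → ℕ → Set
OnContour L i j =
  (L (i Data.Nat.∸ 1) j < L i j) ⊎ (L i (j Data.Nat.∸ 1) < L i j)
  ⊎ (L (i Data.Nat.∸ 1) (j Data.Nat.∸ 1) < L i j)

at : {A : Set} {m : ℕ} → Vec A m → ℕ → Maybe A
at []       _       = nothing
at (a ∷ _)  zero    = just a
at (_ ∷ as) (suc k) = at as k

-- A single cell: given whether it is a match cell, its left input and its top
-- input, return (right output , bottom output).
-- Mismatch cell: comparator, larger (∨) to the right, smaller (∧) to the bottom
-- (on equal inputs both conventions give the same values).
cell : Bool → Bool → Bool → Bool × Bool
cell match l t = if match then (t , l) else (l ∨ t , l ∧ t)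

module LCSNET {A : Set} (_≟_ : DecidableEquality A) {m n : ℕ}
              (x : Vec A m) (y : Vec A n) where

  -- The network uses 1-based cells (i , j); here they are indexed by
  -- ℕ-values i ≥ 1, j ≥ 1. Cells outside [1:m]×[1:n] are never consulted by
  -- cells inside it.
  isMatch : ℕ → ℕ → Bool
  isMatch i j with at x (i Data.Nat.∸ 1) | at y (j Data.Nat.∸ 1)
  ... | just a | just b = ⌊ a ≟ b ⌋
  ... | _      | _      = false

  -- outputs of 0-based cell (i , j) = paper cell (i+1 , j+1)
  outs : ℕ → ℕ → Bool × Bool
  leftIn0 : ℕ → ℕ → Bool
  topIn0  : ℕ → ℕ → Bool

  outs i j = cell (isMatch (suc i) (suc j)) (leftIn0 i j) (topIn0 i j)

  leftIn0 i zero    = true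
  leftIn0 i (suc j) = proj₁ (outs i j)

  topIn0 zero    j = false
  topIn0 (suc i) j = proj₂ (outs i j)

  leftIn topIn rightOut bottomOut : ℕ → ℕ → Bool
  leftIn    i j = leftIn0 (i Data.Nat.∸ 1) (j Data.Nat.∸ 1)
  topIn     i j = topIn0  (i Data.Nat.∸ 1) (j Data.Nat.∸ 1)
  rightOut  i j = proj₁ (outs (i Data.Nat.∸ 1) (j Data.Nat.∸ 1))
  bottomOut i j = proj₂ (outs (i Data.Nat.∸ 1) (j Data.Nat.∸ 1))

  HasStray : ℕ → ℕ → Set
  HasStray i j = (topIn i j ≡ true) ⊎ (leftIn i j ≡ false)
               ⊎ (bottomOut i j ≡ true) ⊎ (rightOut i j ≡ false)

module Submission where

-- Read a wire value as a 0/1 increment of L: writing a = L(i-1,j-1),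
-- p = L(i-1,j), q = L(i,j-1) and r = L(i,j) for cell (i,j), the invariant is
--     p = a + [top input = 1],      q = a + [left input = 0],
--     r = q + [bottom output = 1],  r = p + [right output = 0],
-- i.e. a one travelling down (a zero travelling right) across an edge means
-- that L increases by one across that edge.  The inputs of the boundary cells
-- satisfy it because L vanishes on row 0 and column 0; the outputs of a cell
-- satisfy it whenever its inputs do, by the LCS recurrence
-- (r = a + 1 at a match, r = max p q at a mismatch) and the cell rule.
-- Given the invariant, L(i,j) exceeds one of p, q, a iff one of the four
-- increments is 1, i.e. iff the cell has a stray value.

open import Defs
open import Data.Nat using (ℕ; zero; suc; _+_; _≤_; _<_; z≤n; s≤s)
open import Data.Vec using (Vec; _∷_; toList)
open import Data.List using (take)
open import Function.Bundles using (_⇔_)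
open import Relation.Binary.Definitions using (DecidableEquality)

open import Data.Bool using (Bool; true; false; not; _∧_; _∨_; T)
open import Data.Unit using (tt)
open import Data.Empty using (⊥; ⊥-elim)
open import Data.List using (List; []; _∷_; _++_; length; [_])
open import Data.List.Properties using (∷ʳ-injective; length-++)
open import Data.List.Relation.Binary.Sublist.Propositional
  using (_⊆_; []; _∷_; _∷ʳ_; ⊆-refl; ⊆-trans)
open import Data.List.Relation.Binary.Sublist.Propositional.Properties using (++⁺; ++⁺ʳ)
open import Data.Maybe using (just)
open import Data.Nat.Properties
  using (<⇒≤; ≤-antisym; ≤-trans; <-≤-trans; n≤1+n; n<1+n; m≤n+m; <-irrefl; +-comm)
open import Data.Product using (_×_; _,_; proj₁; proj₂; ∃-syntax)
open import Data.Sum using (_⊎_; inj₁; inj₂)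
open import Function using (_∘_)
open import Function.Bundles using (mk⇔)
open import Relation.Binary.PropositionalEquality
  using (_≡_; refl; sym; trans; cong; subst; subst₂)
open import Relation.Nullary using (¬_)
open import Relation.Nullary.Decidable using (⌊_⌋; toWitness; toWitnessFalse)

bit : Bool → ℕ
bit true  = 1
bit false = 0

module SnocSublists {A : Set} where

  length-snoc : (zs : List A) (a : A) → length (zs ++ [ a ]) ≡ suc (length zs)
  length-snoc zs a = trans (length-++ zs) (+-comm (length zs) 1)

  ⊆-snoc-view : (us : List A) {a : A} {zs : List A} → zs ⊆ us ++ [ a ] →
    (zs ⊆ us) ⊎ (∃[ zs′ ] (zs ≡ zs′ ++ [ a ] × zs′ ⊆ us))
  ⊆-snoc-view []       (_ ∷ʳ p)    = inj₁ p
  ⊆-snoc-view []       (refl ∷ []) = inj₂ ([] , refl , [])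
  ⊆-snoc-view (u ∷ us) (_ ∷ʳ p) with ⊆-snoc-view us p
  ... | inj₁ q                = inj₁ (u ∷ʳ q)
  ... | inj₂ (zs′ , refl , q) = inj₂ (zs′ , refl , u ∷ʳ q)
  ⊆-snoc-view (u ∷ us) (refl ∷ p) with ⊆-snoc-view us p
  ... | inj₁ q                = inj₁ (refl ∷ q)
  ... | inj₂ (zs′ , refl , q) = inj₂ (u ∷ zs′ , refl , refl ∷ q)

  ⊆-snoc : (zs : List A) {a : A} → zs ⊆ zs ++ [ a ]
  ⊆-snoc zs {a} = ++⁺ʳ [ a ] ⊆-refl

  common-snoc-bound : {zs us vs : List A} {u v : A} {k : ℕ} →
    (∀ ws → ws ⊆ us → ws ⊆ vs → length ws ≤ k) →
    zs ⊆ us ++ [ u ] → zs ⊆ vs ++ [ v ] → length zs ≤ suc k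
  common-snoc-bound {zs} {us} {vs} {u} {v} {k} bound p q
    with ⊆-snoc-view us p | ⊆-snoc-view vs q
  ... | inj₁ p′ | inj₁ q′ = ≤-trans (bound zs p′ q′) (n≤1+n k)
  ... | inj₁ p′ | inj₂ (zs′ , refl , q′) =
    subst (_≤ suc k) (sym (length-snoc zs′ v))
      (s≤s (bound zs′ (⊆-trans (⊆-snoc zs′) p′) q′))
  ... | inj₂ (zs′ , refl , p′) | inj₁ q′ =
    subst (_≤ suc k) (sym (length-snoc zs′ u))
      (s≤s (bound zs′ p′ (⊆-trans (⊆-snoc zs′) q′)))
  ... | inj₂ (zs′ , refl , p′) | inj₂ (zs″ , e , q′) with ∷ʳ-injective zs′ zs″ e
  ...   | refl , refl = subst (_≤ suc k) (sym (length-snoc zs′ u)) (s≤s (bound zs′ p′ q′))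

  common-snoc-distinct : {zs us vs : List A} {u v : A} → ¬ u ≡ v →
    zs ⊆ us ++ [ u ] → zs ⊆ vs ++ [ v ] → (zs ⊆ us) ⊎ (zs ⊆ vs)
  common-snoc-distinct {us = us} {vs} u≢v p q with ⊆-snoc-view us p
  ... | inj₁ p′ = inj₁ p′
  ... | inj₂ (zs′ , refl , _) with ⊆-snoc-view vs q
  ...   | inj₁ q′               = inj₂ q′
  ...   | inj₂ (zs″ , e , _) = ⊥-elim (u≢v (proj₂ (∷ʳ-injective zs′ zs″ e)))

  take-suc-at : ∀ {m} (x : Vec A m) k → suc k ≤ m →
    ∃[ a ] (at x k ≡ just a × take (suc k) (toList x) ≡ take k (toList x) ++ [ a ])
  take-suc-at (a ∷ x) zero    _       = a , refl , refl
  take-suc-at (c ∷ x) (suc k) (s≤s h) with take-suc-at x k h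
  ... | a , ea , et = a , ea , cong (c ∷_) et

open SnocSublists

module LCSRecurrence {A : Set} where

  lcs-mono : {us us′ vs vs′ : List A} {k k′ : ℕ} → us ⊆ us′ → vs ⊆ vs′ →
    IsLCSLength us vs k → IsLCSLength us′ vs′ k′ → k ≤ k′
  lcs-mono us⊆ vs⊆ ((zs , p , q , refl) , _) (_ , maximal) =
    maximal zs (⊆-trans p us⊆) (⊆-trans q vs⊆)

  lcs-emptyˡ : {vs : List A} {k : ℕ} → IsLCSLength [] vs k → k ≡ 0
  lcs-emptyˡ ((.[] , [] , _ , e) , _) = sym e

  lcs-emptyʳ : {us : List A} {k : ℕ} → IsLCSLength us [] k → k ≡ 0
  lcs-emptyʳ ((.[] , _ , [] , e) , _) = sym e

  lcs-snoc-≤ : {us vs : List A} {u v : A} {a r : ℕ} →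
    IsLCSLength us vs a → IsLCSLength (us ++ [ u ]) (vs ++ [ v ]) r → r ≤ suc a
  lcs-snoc-≤ (_ , maximal) ((zs , p , q , refl) , _) = common-snoc-bound maximal p q

  lcs-snoc-match : {us vs : List A} {u : A} {a r : ℕ} →
    IsLCSLength us vs a → IsLCSLength (us ++ [ u ]) (vs ++ [ u ]) r → suc a ≤ r
  lcs-snoc-match {u = u} ((zs , p , q , refl) , _) (_ , maximal) =
    subst (_≤ _) (length-snoc zs u) (maximal (zs ++ [ u ]) (++⁺ p ⊆-refl) (++⁺ q ⊆-refl))

  lcs-snoc-mismatch : {us vs : List A} {u v : A} {p q r : ℕ} → ¬ u ≡ v →
    IsLCSLength us (vs ++ [ v ]) p → IsLCSLength (us ++ [ u ]) vs q →
    IsLCSLength (us ++ [ u ]) (vs ++ [ v ]) r → (r ≤ p) ⊎ (r ≤ q)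
  lcs-snoc-mismatch u≢v (_ , maximalᵖ) (_ , maximalᑫ) ((zs , zs⊆us , zs⊆vs , refl) , _)
    with common-snoc-distinct u≢v zs⊆us zs⊆vs
  ... | inj₁ zs⊆us′ = inj₁ (maximalᵖ zs zs⊆us′ zs⊆vs)
  ... | inj₂ zs⊆vs′ = inj₂ (maximalᑫ zs zs⊆us zs⊆vs′)

open LCSRecurrence

-- Local picture of a cell: a, p, q, r stand for L at its upper-left, upper,
-- left and own corner, i.e. L(i-1,j-1), L(i-1,j), L(i,j-1), L(i,j).
module CellArithmetic where

  InputsEncode : Bool → Bool → ℕ → ℕ → ℕ → Set
  InputsEncode t l a p q = (p ≡ bit t + a) × (q ≡ bit (not l) + a)

  OutputsEncode : Bool × Bool → ℕ → ℕ → ℕ → Set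
  OutputsEncode out p q r = (r ≡ bit (proj₂ out) + q) × (r ≡ bit (not (proj₁ out)) + p)

  record CellRecurrence (match : Bool) (a p q r : ℕ) : Set where
    field
      above≤     : p ≤ r
      left≤      : q ≤ r
      ≤diagonal+1 : r ≤ suc a
      onMatch    : match ≡ true → suc a ≤ r
      onMismatch : match ≡ false → (r ≤ p) ⊎ (r ≤ q)

  match-transfer : (l t : Bool) {a p q r : ℕ} → InputsEncode t l a p q → r ≡ suc a →
    OutputsEncode (t , l) p q r
  match-transfer l t (ep , eq) er = bottom l eq er , right t ep er
    where
    bottom : ∀ l {a q r} → q ≡ bit (not l) + a → r ≡ suc a → r ≡ bit l + q
    bottom true  refl refl = refl
    bottom false refl refl = refl
    right : ∀ t {a p r} → p ≡ bit t + a → r ≡ suc a → r ≡ bit (not t) + p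
    right true  refl refl = refl
    right false refl refl = refl

  -- At a mismatch cell r = max p q, which is what the comparator computes.
  mismatch-transfer : (l t : Bool) {a p q r : ℕ} → InputsEncode t l a p q →
    p ≤ r → q ≤ r → r ≤ suc a → (r ≤ p) ⊎ (r ≤ q) →
    OutputsEncode (l ∨ t , l ∧ t) p q r
  mismatch-transfer true  true  (refl , refl) p≤r _   r≤a+1 _ with ≤-antisym r≤a+1 p≤r
  ... | refl = refl , refl
  mismatch-transfer false false (refl , refl) _   q≤r r≤a+1 _ with ≤-antisym r≤a+1 q≤r
  ... | refl = refl , refl
  mismatch-transfer false true  (refl , refl) p≤r _   r≤a+1 _ with ≤-antisym r≤a+1 p≤r
  ... | refl = refl , refl
  mismatch-transfer true  false (refl , refl) p≤r _   _ (inj₁ r≤p) with ≤-antisym r≤p p≤r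
  ... | refl = refl , refl
  mismatch-transfer true  false (refl , refl) p≤r _   _ (inj₂ r≤q) with ≤-antisym r≤q p≤r
  ... | refl = refl , refl

  cell-transfer : (match l t : Bool) {a p q r : ℕ} → InputsEncode t l a p q →
    CellRecurrence match a p q r → OutputsEncode (cell match l t) p q r
  cell-transfer true  l t enc rec =
    match-transfer l t enc (≤-antisym ≤diagonal+1 (onMatch refl))
    where open CellRecurrence rec
  cell-transfer false l t enc rec =
    mismatch-transfer l t enc above≤ left≤ ≤diagonal+1 (onMismatch refl)
    where open CellRecurrence rec

  increment-≤ : ∀ b {m n : ℕ} → n ≡ bit b + m → m ≤ n
  increment-≤ b {m} refl = m≤n+m m (bit b)

  increment-< : {m n : ℕ} → n ≡ bit true + m → m < n
  increment-< {m} refl = n<1+n m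

  rise⇔stray : (t l ro bo : Bool) {a p q r : ℕ} →
    InputsEncode t l a p q → OutputsEncode (ro , bo) p q r →
    ((p < r) ⊎ (q < r) ⊎ (a < r)) ⇔ ((t ≡ true) ⊎ (l ≡ false) ⊎ (bo ≡ true) ⊎ (ro ≡ false))
  rise⇔stray t l ro bo {a} {p} {q} {r} inputs outputs =
    mk⇔ (stray-of-rise t l ro bo inputs outputs) rise-of-stray
    where
    p≤r : p ≤ r
    p≤r = increment-≤ (not ro) (proj₂ outputs)
    q≤r : q ≤ r
    q≤r = increment-≤ bo (proj₁ outputs)

    -- Without stray values p = q = r = a, so L does not rise.
    stray-of-rise : (t l ro bo : Bool) {a p q r : ℕ} →
      InputsEncode t l a p q → OutputsEncode (ro , bo) p q r →
      ((p < r) ⊎ (q < r) ⊎ (a < r)) → (t ≡ true) ⊎ (l ≡ false) ⊎ (bo ≡ true) ⊎ (ro ≡ false)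
    stray-of-rise true  _     _     _     _ _ _ = inj₁ refl
    stray-of-rise false false _     _     _ _ _ = inj₂ (inj₁ refl)
    stray-of-rise false true  _     true  _ _ _ = inj₂ (inj₂ (inj₁ refl))
    stray-of-rise false true  false false _ _ _ = inj₂ (inj₂ (inj₂ refl))
    stray-of-rise false true  true  false (refl , refl) (refl , _) rise = ⊥-elim (no-rise rise)
      where
      no-rise : ∀ {a} → (a < a) ⊎ (a < a) ⊎ (a < a) → ⊥
      no-rise (inj₁ a<a)         = <-irrefl refl a<a
      no-rise (inj₂ (inj₁ a<a)) = <-irrefl refl a<a
      no-rise (inj₂ (inj₂ a<a)) = <-irrefl refl a<a

    -- A stray input raises L along its edge, a stray output along the other.
    rise-of-stray : (t ≡ true) ⊎ (l ≡ false) ⊎ (bo ≡ true) ⊎ (ro ≡ false) →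
      (p < r) ⊎ (q < r) ⊎ (a < r)
    rise-of-stray (inj₁ refl)                = inj₂ (inj₂ (<-≤-trans (increment-< (proj₁ inputs)) p≤r))
    rise-of-stray (inj₂ (inj₁ refl))         = inj₂ (inj₂ (<-≤-trans (increment-< (proj₂ inputs)) q≤r))
    rise-of-stray (inj₂ (inj₂ (inj₁ refl))) = inj₂ (inj₁ (increment-< (proj₁ outputs)))
    rise-of-stray (inj₂ (inj₂ (inj₂ refl))) = inj₁ (increment-< (proj₂ outputs))

open CellArithmetic

-- The network read against the LCS table.  Indices here are 0-based:
-- cell (i , j) is the paper's cell (i+1 , j+1), and its corners carry
-- L i j, L i (suc j), L (suc i) j and L (suc i) (suc j).
module Network {A : Set} (_≟_ : DecidableEquality A) {m n : ℕ}
    (x : Vec A m) (y : Vec A n) (L : ℕ → ℕ → ℕ)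
    (lcs : ∀ i j → i ≤ m → j ≤ n →
           IsLCSLength (take i (toList x)) (take j (toList y)) (L i j)) where
  open LCSNET _≟_ x y

  X : ℕ → List A
  X i = take i (toList x)

  Y : ℕ → List A
  Y j = take j (toList y)

  L-row0 : ∀ j → j ≤ n → L 0 j ≡ 0
  L-row0 j j≤n = lcs-emptyˡ (lcs 0 j z≤n j≤n)

  L-column0 : ∀ i → i ≤ m → L i 0 ≡ 0
  L-column0 i i≤m = lcs-emptyʳ (lcs i 0 i≤m z≤n)

  isMatch-letters : ∀ {i j u v} → at x i ≡ just u → at y j ≡ just v →
    isMatch (suc i) (suc j) ≡ ⌊ u ≟ v ⌋
  isMatch-letters xᵢ≡u yⱼ≡v rewrite xᵢ≡u | yⱼ≡v = refl

  letters-agree : ∀ {u v} → ⌊ u ≟ v ⌋ ≡ true → u ≡ v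
  letters-agree e = toWitness (subst T (sym e) tt)

  letters-differ : ∀ {u v} → ⌊ u ≟ v ⌋ ≡ false → ¬ u ≡ v
  letters-differ e = toWitnessFalse (subst (T ∘ not) (sym e) tt)

  recurrence : ∀ i j → suc i ≤ m → suc j ≤ n →
    CellRecurrence (isMatch (suc i) (suc j))
      (L i j) (L i (suc j)) (L (suc i) j) (L (suc i) (suc j))
  recurrence i j i<m j<n with take-suc-at x i i<m | take-suc-at y j j<n
  ... | u , xᵢ≡u , Xi+1 | v , yⱼ≡v , Yj+1 = record
    { above≤      = lcs-mono (⊆-snoc (X i)) ⊆-refl above corner
    ; left≤       = lcs-mono ⊆-refl (⊆-snoc (Y j)) left corner
    ; ≤diagonal+1 = lcs-snoc-≤ diagonal corner
    ; onMatch     = λ match → lcs-snoc-match diagonal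
        (subst (λ w → IsLCSLength (X i ++ [ u ]) (Y j ++ [ w ]) _)
          (sym (letters-agree (trans (sym (isMatch-letters xᵢ≡u yⱼ≡v)) match))) corner)
    ; onMismatch  = λ mismatch → lcs-snoc-mismatch
        (letters-differ (trans (sym (isMatch-letters xᵢ≡u yⱼ≡v)) mismatch)) above left corner
    }
    where
    diagonal : IsLCSLength (X i) (Y j) (L i j)
    diagonal = lcs i j (<⇒≤ i<m) (<⇒≤ j<n)
    above : IsLCSLength (X i) (Y j ++ [ v ]) (L i (suc j))
    above = subst (λ vs → IsLCSLength (X i) vs _) Yj+1 (lcs i (suc j) (<⇒≤ i<m) j<n)
    left : IsLCSLength (X i ++ [ u ]) (Y j) (L (suc i) j)
    left = subst (λ us → IsLCSLength us (Y j) _) Xi+1 (lcs (suc i) j i<m (<⇒≤ j<n))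
    corner : IsLCSLength (X i ++ [ u ]) (Y j ++ [ v ]) (L (suc i) (suc j))
    corner = subst₂ (λ us vs → IsLCSLength us vs _) Xi+1 Yj+1 (lcs (suc i) (suc j) i<m j<n)

  inputs-encode : ∀ i j → suc i ≤ m → suc j ≤ n →
    InputsEncode (topIn0 i j) (leftIn0 i j) (L i j) (L i (suc j)) (L (suc i) j)
  outputs-encode : ∀ i j → suc i ≤ m → suc j ≤ n →
    OutputsEncode (outs i j) (L i (suc j)) (L (suc i) j) (L (suc i) (suc j))
  top-encodes : ∀ i j → suc i ≤ m → suc j ≤ n → L i (suc j) ≡ bit (topIn0 i j) + L i j
  left-encodes : ∀ i j → suc i ≤ m → suc j ≤ n → L (suc i) j ≡ bit (not (leftIn0 i j)) + L i j

  inputs-encode i j i<m j<n = top-encodes i j i<m j<n , left-encodes i j i<m j<n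

  outputs-encode i j i<m j<n =
    cell-transfer (isMatch (suc i) (suc j)) (leftIn0 i j) (topIn0 i j)
      (inputs-encode i j i<m j<n) (recurrence i j i<m j<n)

  top-encodes zero    j _   j<n = trans (L-row0 (suc j) j<n) (sym (L-row0 j (<⇒≤ j<n)))
  top-encodes (suc i) j i<m j<n = proj₁ (outputs-encode i j (<⇒≤ i<m) j<n)

  left-encodes i zero    i<m _   = trans (L-column0 (suc i) i<m) (sym (L-column0 i (<⇒≤ i<m)))
  left-encodes i (suc j) i<m j<n = proj₂ (outputs-encode i j i<m (<⇒≤ j<n))

  contour⇔stray : ∀ i j → suc i ≤ m → suc j ≤ n →
    OnContour L (suc i) (suc j) ⇔ HasStray (suc i) (suc j)
  contour⇔stray i j i<m j<n =
    rise⇔stray (topIn0 i j) (leftIn0 i j) (proj₁ (outs i j)) (proj₂ (outs i j))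
      (inputs-encode i j i<m j<n) (outputs-encode i j i<m j<n)

theorem4 : {A : Set} (_≟_ : DecidableEquality A) {m n : ℕ}
    (x : Vec A m) (y : Vec A n) (L : ℕ → ℕ → ℕ) →
    (∀ i j → i ≤ m → j ≤ n → IsLCSLength (take i (toList x)) (take j (toList y)) (L i j)) →
    ∀ i j → 1 ≤ i → i ≤ m → 1 ≤ j → j ≤ n →
    OnContour L i j ⇔ LCSNET.HasStray _≟_ x y i j
theorem4 _≟_ x y L lcs (suc i) (suc j) _ i≤m _ j≤n =
  Network.contour⇔stray _≟_ x y L lcs i j i≤m j≤n
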